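{- Let $(G,\prec)$ be a Nyldon-like set over $A$ and let $u_1,u_2,\dots,u_m$ be $G$-words (blocks) such that for every finite sequence $a_1,\dots,a_i$ of indices in $\{1,\dots,m\}$ (repetitions and any order allowed), every $G$-factorization of $u_{a_1}u_{a_2}\cdots u_{a_i}$ preserves the blocks $u_{a_1},\dots,u_{a_i}$. Let $u_k$ (with $k\ge 2$) be a $\prec$-smallest element among $u_1,\dots,u_m$, and suppose $u_{k-1}\succ u_k$. Replace the two blocks $u_{k-1},u_k$ by the single block $u_{k-1}u_k$, obtaining the list of blocks $u_1,\dots,u_{k-2},u_{k-1}u_k,u_{k+1},\dots,u_m$. Then for every finite sequence of blocks from this new list (repetitions and any order allowed), every $G$-factorization of their concatenation preserves these blocks.
   Context: $A$ is a finite alphabet with at least two letters. For $w\in A^+$, a $G$-factorization of $w$ is a sequence $(w_1,\dots,w_k)$, $k\ge 1$, of words of $G$ with $w=w_1w_2\cdots w_k$ and $w_1\preceq w_2\preceq\cdots\preceq w_k$. A Nyldon-like set is a pair $(G,\prec)$ with $G\subseteq A^+$ and $\prec$ a total order on $G$ such that: every letter of $A$ lies in $G$; a word $w$ of length at least $2$ lies in $G$ if and only if $w$ has no $G$-factorization with $k\ge 2$ factors; and for all $f,g\in G$ with $fg\in G$ we have $f\prec fg$. Elements of $G$ are called $G$-words. If $w=v_1v_2\cdots v_r$ is viewed as a concatenation of blocks $v_1,\dots,v_r$ (at fixed positions), a factorization $(n_1,\dots,n_s)$ of $w$ preserves the blocks if each $n_i$ is a concatenation of consecutive blocks, i.e.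 no factor starts or ends strictly inside a block. -}

module Defs where

open import Data.Nat using (ℕ; suc; _≤_)
open import Data.Fin using (Fin)
open import Data.List using (List; []; _∷_; _++_; concat; map; length; lookup)
open import Data.List.Relation.Unary.All using (All)
open import Data.List.Relation.Unary.Linked using (Linked)
open import Data.List.Membership.Propositional using (_∈_)
open import Data.Product using (Σ; _×_; _,_)
open import Data.Sum using (_⊎_)
open import Relation.Binary.PropositionalEquality using (_≡_; _≢_)
open import Relation.Nullary using (¬_)
open import Function.Bundles using (_⇔_)

Letter : ℕ → Set
Letter n = Fin (suc (suc n))

Word : ℕ → Set
Word n = List (Letter n)

module _ {n : ℕ} (G : Word n → Set) (_≺_ : Word n → Word n → Set) where

  _⪯_ : Word n → Word n → Set
  f ⪯ g = f ≺ g ⊎ f ≡ g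

  record IsGFactorization (ws : List (Word n)) (w : Word n) : Set where
    field
      nonemptySeq : 1 ≤ length ws
      allG        : All G ws
      product     : concat ws ≡ w
      nondecr     : Linked _⪯_ ws

  HasProperGFactorization : Word n → Set
  HasProperGFactorization w =
    Σ (List (Word n)) λ ws → (2 ≤ length ws) × IsGFactorization ws w

  record NyldonLike : Set where
    field
      G-nonempty  : ∀ w → G w → w ≢ []
      ≺-irrefl    : ∀ f → G f → ¬ (f ≺ f)
      ≺-trans     : ∀ f g h → G f → G g → G h → f ≺ g → g ≺ h → f ≺ h
      ≺-total     : ∀ f g → G f → G g → f ≺ g ⊎ f ≡ g ⊎ g ≺ f
      letters     : ∀ (a : Letter n) → G (a ∷ [])
      characterization : ∀ w → 2 ≤ length w → (G w ⇔ (¬ HasProperGFactorization w))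
      prefix-≺    : ∀ f g → G f → G g → G (f ++ g) → f ≺ (f ++ g)

  PreservesBlocks : List (Word n) → List (Word n) → Set
  PreservesBlocks vs ns =
    Σ (List (List (Word n))) λ groups → (concat groups ≡ vs) × (map concat groups ≡ ns)

  BlockPreserving : List (Word n) → Set
  BlockPreserving us =
    ∀ (is : List (Fin (length us))) (ws : List (Word n)) →
      IsGFactorization ws (concat (map (lookup us) is)) →
      PreservesBlocks (map (lookup us) is) ws

-- Write S for the old blocks and S⁺ for S together with the glued block x ++ y. A G-factorization
-- of a product of S⁺-blocks preserves the underlying S-blocks, so it can only go wrong by cutting
-- a glued block between x and y. The factor ending in x is then ≻ y, because y is ≺-minimal and
-- the first block of a G-word made of several blocks precedes that word; so the next factor is not
-- y alone. Nor is it y followed by further blocks: y can be prepended to a G-factorization of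
-- those blocks, so such a word is not in G.
-- The fact about first blocks is proved together with the theorem, by induction on the length:
-- the theorem for words of length ≤ L uses the fact below L, and the fact at L follows by
-- repeatedly gluing a ≺-minimal block to its larger left neighbour (each gluing keeps block
-- preservation, by the theorem) until one reaches a G-factorization whose first factor is ⪰ the
-- first block; a G-word has no factorization but itself.

module Submission where

open import Data.Nat using (ℕ; zero; suc; _≤_; _<_; z≤n; s≤s)
open import Data.Nat.Properties using (≤-refl; ≤-trans; ≤-pred; <⇒≤; ≤-<-trans; <-≤-trans; n≤1+n)
open import Data.Fin using (Fin)
open import Data.List using (List; []; _∷_; _++_; concat; map; length; lookup)
open import Data.List.Properties
  using (∷-injective; ∷-injectiveʳ; ++-assoc; ++-identityʳ; ++-identityʳ-unique; ++-conicalˡ; length-++-≤ˡ)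
open import Data.List.Properties using (length-++-≤ʳ)
open import Data.List.Relation.Unary.All as All using (All; []; _∷_)
open import Data.List.Relation.Unary.All.Properties using (++⁺; ++⁻ˡ; concat⁻; map⁺; map⁻)
open import Data.List.Relation.Unary.Any using (here; there; index)
open import Data.List.Relation.Unary.Any.Properties using (lookup-index)
open import Data.List.Relation.Unary.Linked as Linked using (Linked; [-]; _∷_)
open import Data.List.Membership.Propositional using (_∈_)
open import Data.List.Membership.Propositional.Properties using (∈-lookup; ∈-++⁺ʳ)
open import Data.Product using (∃; ∃₂; _×_; _,_)
open import Data.Sum using (_⊎_; inj₁; inj₂)
open import Data.Empty using (⊥; ⊥-elim)
open import Function.Bundles using (Equivalence)
open import Level using (0ℓ)
open import Relation.Binary.PropositionalEquality using (_≡_; _≢_; refl; sym; trans; cong; cong₂; subst)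
open import Relation.Nullary using (¬_)
open import Relation.Unary using (Pred; _⊆_; _∪_; ｛_｝)

open import Defs using (Word; NyldonLike)
open Defs.IsGFactorization using (allG; product; nondecr)

module _ {A : Set} where

  ++-≢[]ˡ : ∀ {xs ys : List A} → xs ≢ [] → xs ++ ys ≢ []
  ++-≢[]ˡ {xs} {ys} xs≢[] eq = xs≢[] (++-conicalˡ xs ys eq)

  length-++-<ˡ : ∀ (xs : List A) {ys} → ys ≢ [] → length xs < length (xs ++ ys)
  length-++-<ˡ []       {[]}    ys≢[] = ⊥-elim (ys≢[] refl)
  length-++-<ˡ []       {_ ∷ _} _     = s≤s z≤n
  length-++-<ˡ (_ ∷ xs) ys≢[]         = s≤s (length-++-<ˡ xs ys≢[])

  length-++-<ʳ : ∀ (xs : List A) {ys} → xs ≢ [] → length ys < length (xs ++ ys)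
  length-++-<ʳ []       xs≢[] = ⊥-elim (xs≢[] refl)
  length-++-<ʳ (_ ∷ xs) {ys} _ = s≤s (length-++-≤ʳ ys {xs})

  length-++-++-≤ : ∀ (xs ys : List A) {zs} → length (xs ++ ys) ≤ length (xs ++ ys ++ zs)
  length-++-++-≤ []       ys = length-++-≤ˡ ys
  length-++-++-≤ (_ ∷ xs) ys = s≤s (length-++-++-≤ xs ys)

  2≤length-++ : ∀ {xs ys : List A} → xs ≢ [] → ys ≢ [] → 2 ≤ length (xs ++ ys)
  2≤length-++ {[]}     xs≢[] _     = ⊥-elim (xs≢[] refl)
  2≤length-++ {_ ∷ xs} _     ys≢[] = s≤s (≤-trans (s≤s z≤n) (length-++-<ˡ xs ys≢[]))

  ∈⇒length≤concat : ∀ {w : List A} {ws} → w ∈ ws → length w ≤ length (concat ws)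
  ∈⇒length≤concat {w} (here refl)            = length-++-≤ˡ w
  ∈⇒length≤concat {ws = v ∷ _} (there w∈ws) = ≤-trans (∈⇒length≤concat w∈ws) (length-++-≤ʳ _ {v})

  concat≡∷ : ∀ {x : A} {xs} gs → All (_≢ []) gs → concat gs ≡ x ∷ xs → ∃₂ λ g hs → gs ≡ (x ∷ g) ∷ hs
  concat≡∷ []             _         ()
  concat≡∷ ([] ∷ _)       (ne ∷ _) _    = ⊥-elim (ne refl)
  concat≡∷ ((_ ∷ g) ∷ hs) _        refl = g , hs , refl

  concat≡[_] : ∀ (x : A) gs → All (_≢ []) gs → concat gs ≡ x ∷ [] → gs ≡ (x ∷ []) ∷ []
  concat≡[ x ] []                     _             ()
  concat≡[ x ] ([] ∷ _)               (ne ∷ _)      _   = ⊥-elim (ne refl)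
  concat≡[ x ] ((_ ∷ []) ∷ [])        _             refl = refl
  concat≡[ x ] ((_ ∷ []) ∷ g ∷ gs)    (_ ∷ ne ∷ _)  eq  =
    ⊥-elim (ne (++-conicalˡ g (concat gs) (∷-injectiveʳ eq)))
  concat≡[ x ] ((_ ∷ _ ∷ _) ∷ _)      _             ()

  indices : ∀ {xs vs : List A} → All (_∈ xs) vs → ∃ λ (is : List (Fin (length xs))) → map (lookup xs) is ≡ vs
  indices [] = [] , refl
  indices (v∈xs ∷ vs⊆xs) with indices vs⊆xs
  ... | is , refl = index v∈xs ∷ is , cong (_∷ _) (sym (lookup-index v∈xs))

  ∈-merge : ∀ (pre : List (List A)) {a b post u} →
    u ∈ pre ++ (a ++ b) ∷ post → u ∈ pre ++ a ∷ b ∷ post ⊎ a ++ b ≡ u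
  ∈-merge []        (here refl) = inj₂ refl
  ∈-merge []        (there u∈)  = inj₁ (there (there u∈))
  ∈-merge (_ ∷ _)   (here refl) = inj₁ (here refl)
  ∈-merge (_ ∷ pre) (there u∈)  with ∈-merge pre u∈
  ... | inj₁ u∈′ = inj₁ (there u∈′)
  ... | inj₂ eq  = inj₂ eq

  All-merge : ∀ {P : Pred (List A) 0ℓ} (pre : List (List A)) {a b post} →
    All P (pre ++ a ∷ b ∷ post) → P (a ++ b) → All P (pre ++ (a ++ b) ∷ post)
  All-merge []        (_ ∷ _ ∷ Ppost) Pab = Pab ∷ Ppost
  All-merge (_ ∷ pre) (Pp ∷ Ps)       Pab = Pp ∷ All-merge pre Ps Pab

  length-merge : ∀ (pre : List (List A)) {a b post} →
    length (pre ++ a ∷ b ∷ post) ≡ suc (length (pre ++ (a ++ b) ∷ post))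
  length-merge []        = refl
  length-merge (_ ∷ pre) = cong suc (length-merge pre)

  concat-merge : ∀ (pre : List (List A)) {a b post} →
    concat (pre ++ (a ++ b) ∷ post) ≡ concat (pre ++ a ∷ b ∷ post)
  concat-merge []        {a} {b} {post} = ++-assoc a b (concat post)
  concat-merge (p ∷ pre)                = cong (p ++_) (concat-merge pre)

module BlockPreservation {n : ℕ} (G : Word n → Set) (_≺_ : Word n → Word n → Set) where

  infix 4 _⪯_

  _⪯_ : Word n → Word n → Set
  _⪯_ = Defs._⪯_ G _≺_

  IsGFactorization : List (Word n) → Word n → Set
  IsGFactorization = Defs.IsGFactorization G _≺_

  PreservesBlocks : List (Word n) → List (Word n) → Set
  PreservesBlocks = Defs.PreservesBlocks G _≺_

  BlockPreserving≤ : ℕ → Pred (Word n) 0ℓ → Set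
  BlockPreserving≤ L S = ∀ vs → All S vs → length (concat vs) ≤ L →
    ∀ {ws} → IsGFactorization ws (concat vs) → PreservesBlocks vs ws

  BlockPreserving≤-⊆ : ∀ {L S₁ S₂} → S₁ ⊆ S₂ → BlockPreserving≤ L S₂ → BlockPreserving≤ L S₁
  BlockPreserving≤-⊆ S₁⊆S₂ bp vs S₁vs = bp vs (All.map S₁⊆S₂ S₁vs)

  BlockPreserving≤-≤ : ∀ {L₁ L₂ S} → L₁ ≤ L₂ → BlockPreserving≤ L₂ S → BlockPreserving≤ L₁ S
  BlockPreserving≤-≤ L₁≤L₂ bp vs Svs len = bp vs Svs (≤-trans len L₁≤L₂)

  toBlockPreserving≤ : ∀ {us} → Defs.BlockPreserving G _≺_ us → ∀ L → BlockPreserving≤ L (_∈ us)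
  toBlockPreserving≤ bp L vs vs⊆us _ F with indices vs⊆us
  ... | is , refl = bp is _ F

  fromBlockPreserving≤ : ∀ {us S} → (_∈ us) ⊆ S → (∀ L → BlockPreserving≤ L S) → Defs.BlockPreserving G _≺_ us
  fromBlockPreserving≤ {us} us⊆S bp is _ F =
    bp _ (map (lookup us) is) (map⁺ (All.universal (λ i → us⊆S (∈-lookup i)) is)) ≤-refl F

module NyldonLikeBlocks {n : ℕ} {G : Word n → Set} {_≺_ : Word n → Word n → Set} (NL : NyldonLike G _≺_) where

  open NyldonLike NL
  open BlockPreservation G _≺_

  ⪯-refl : ∀ {f} → f ⪯ f
  ⪯-refl = inj₂ refl

  ≺-⪯-trans : ∀ {f g h} → G f → G g → G h → f ≺ g → g ⪯ h → f ≺ h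
  ≺-⪯-trans Gf Gg Gh f≺g (inj₁ g≺h) = ≺-trans _ _ _ Gf Gg Gh f≺g g≺h
  ≺-⪯-trans _  _  _  f≺g (inj₂ refl) = f≺g

  ⪯-≺-trans : ∀ {f g h} → G f → G g → G h → f ⪯ g → g ≺ h → f ≺ h
  ⪯-≺-trans Gf Gg Gh (inj₁ f≺g) g≺h = ≺-trans _ _ _ Gf Gg Gh f≺g g≺h
  ⪯-≺-trans _  _  _  (inj₂ refl) g≺h = g≺h

  ⪯-trans : ∀ {f g h} → G f → G g → G h → f ⪯ g → g ⪯ h → f ⪯ h
  ⪯-trans Gf Gg Gh (inj₁ f≺g) g⪯h = inj₁ (≺-⪯-trans Gf Gg Gh f≺g g⪯h)
  ⪯-trans _  _  _  (inj₂ refl) g⪯h = g⪯h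

  ≺⇒⋡ : ∀ {f g} → G f → G g → f ≺ g → ¬ (g ⪯ f)
  ≺⇒⋡ Gf Gg f≺g g⪯f = ≺-irrefl _ Gf (≺-⪯-trans Gf Gg Gf f≺g g⪯f)

  ⪯-or-≻ : ∀ {f g} → G f → G g → f ⪯ g ⊎ g ≺ f
  ⪯-or-≻ Gf Gg with ≺-total _ _ Gf Gg
  ... | inj₁ f≺g        = inj₁ (inj₁ f≺g)
  ... | inj₂ (inj₁ f≡g) = inj₁ (inj₂ f≡g)
  ... | inj₂ (inj₂ g≺f) = inj₂ g≺f

  ⪯-All-trans : ∀ {c m us} → G c → G m → c ⪯ m → All G us → All (m ⪯_) us → All (c ⪯_) us
  ⪯-All-trans _  _  _   []         []           = []
  ⪯-All-trans Gc Gm c⪯m (Gu ∷ Gus) (m⪯u ∷ m⪯us) = ⪯-trans Gc Gm Gu c⪯m m⪯u ∷ ⪯-All-trans Gc Gm c⪯m Gus m⪯us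

  groups-nonempty : ∀ {gs} → All G (map concat gs) → All (_≢ []) gs
  groups-nonempty Ggs = All.map (λ {g} Gg g≡[] → G-nonempty (concat g) Gg (cong concat g≡[])) (map⁻ Ggs)

  singleton-factorization : ∀ {w} → G w → IsGFactorization (w ∷ []) w
  singleton-factorization {w} Gw = record
    { nonemptySeq = s≤s z≤n
    ; allG        = Gw ∷ []
    ; product     = ++-identityʳ w
    ; nondecr     = [-]
    }

  ∷-factorization : ∀ {f e es w} → G f → f ⪯ e →
    IsGFactorization (e ∷ es) w → IsGFactorization (f ∷ e ∷ es) (f ++ w)
  ∷-factorization {f} Gf f⪯e F = record
    { nonemptySeq = s≤s z≤n
    ; allG        = Gf ∷ allG F
    ; product     = cong (f ++_) (product F)
    ; nondecr     = f⪯e ∷ nondecr F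
    }

  length-head-factor≤ : ∀ {e es w} → IsGFactorization (e ∷ es) w → length e ≤ length w
  length-head-factor≤ {e} F = subst (λ w → length e ≤ length w) (product F) (length-++-≤ˡ e)

  ¬proper⇒G : ∀ {w} → 2 ≤ length w → (∀ {ws} → 2 ≤ length ws → ¬ IsGFactorization ws w) → G w
  ¬proper⇒G 2≤w no-proper = Equivalence.from (characterization _ 2≤w) λ { (_ , 2≤ws , F) → no-proper 2≤ws F }

  G⇒¬proper : ∀ {w ws} → G w → 2 ≤ length w → 2 ≤ length ws → ¬ IsGFactorization ws w
  G⇒¬proper Gw 2≤w 2≤ws F = Equivalence.to (characterization _ 2≤w) Gw (_ , 2≤ws , F)

  -- G need not be decidable, so a G-factorization is only available doubly negated.
  ¬¬-factorization : ∀ {w} → w ≢ [] → ¬ ¬ ∃ λ ws → IsGFactorization ws w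
  ¬¬-factorization {[]}        w≢[] _ = w≢[] refl
  ¬¬-factorization {a ∷ []}    _ no-factorization =
    no-factorization (_ , singleton-factorization (letters a))
  ¬¬-factorization {_ ∷ _ ∷ _} _ no-factorization =
    no-factorization (_ , singleton-factorization (¬proper⇒G (s≤s (s≤s z≤n)) λ _ F →
      no-factorization (_ , F)))

  HeadBlock≺ : ℕ → Set₁
  HeadBlock≺ L = ∀ {S : Pred (Word n) 0ℓ} → S ⊆ G → BlockPreserving≤ L S →
    ∀ c d cs → All S (c ∷ d ∷ cs) → length (concat (c ∷ d ∷ cs)) < L →
    G (concat (c ∷ d ∷ cs)) → c ≺ concat (c ∷ d ∷ cs)

  module Merge (L : ℕ) (ih : HeadBlock≺ L) {S : Pred (Word n) 0ℓ} (S⊆G : S ⊆ G) (bp : BlockPreserving≤ L S)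
               {x y : Word n} (Sx : S x) (Sy : S y) (y-min : ∀ {u} → S u → y ⪯ u) (y≺x : y ≺ x) where

    private
      Gx : G x
      Gx = S⊆G Sx

      Gy : G y
      Gy = S⊆G Sy

      y++≢[] : ∀ {v} → y ++ v ≢ []
      y++≢[] = ++-≢[]ˡ (G-nonempty y Gy)

    y≺concat : ∀ c d ds → All S (c ∷ d ∷ ds) → length (concat (c ∷ d ∷ ds)) < L →
      G (concat (c ∷ d ∷ ds)) → y ≺ concat (c ∷ d ∷ ds)
    y≺concat c d ds Scds len Gw =
      ⪯-≺-trans Gy (S⊆G (All.head Scds)) Gw (y-min (All.head Scds)) (ih S⊆G bp c d ds Scds len Gw)

    y⪯concat : ∀ c g → All S (c ∷ g) → length (concat (c ∷ g)) < L → G (concat (c ∷ g)) → y ⪯ concat (c ∷ g)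
    y⪯concat c []      (Sc ∷ []) _   _  = subst (y ⪯_) (sym (++-identityʳ c)) (y-min Sc)
    y⪯concat c (d ∷ g) Scdg      len Gw = inj₁ (y≺concat c d g Scdg len Gw)

    y≺concat-∷ʳx : ∀ g → All S g → length (concat (g ++ x ∷ [])) < L →
      G (concat (g ++ x ∷ [])) → y ≺ concat (g ++ x ∷ [])
    y≺concat-∷ʳx []          _           = λ _ _ → subst (y ≺_) (sym (++-identityʳ x)) y≺x
    y≺concat-∷ʳx (c ∷ [])    (Sc ∷ [])   = y≺concat c x [] (Sc ∷ Sx ∷ [])
    y≺concat-∷ʳx (c ∷ d ∷ g) (Sc ∷ Sdg) = y≺concat c d (g ++ x ∷ []) (Sc ∷ ++⁺ Sdg (Sx ∷ []))

    -- y can be put in front of a G-factorization of the blocks, whose first factor is ⪰ y.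
    y++concat∉G : ∀ c p → All S (c ∷ p) → length (y ++ concat (c ∷ p)) < L → ¬ G (y ++ concat (c ∷ p))
    y++concat∉G c p Scp len Gyw = ¬¬-factorization w≢[] λ { (_ , F) → prepend-y F }
      where
        w≢[] : concat (c ∷ p) ≢ []
        w≢[] = ++-≢[]ˡ (G-nonempty c (S⊆G (All.head Scp)))

        len-w : length (concat (c ∷ p)) < L
        len-w = ≤-<-trans (length-++-≤ʳ _ {y}) len

        prepend-y : ∀ {ws} → IsGFactorization ws (concat (c ∷ p)) → ⊥
        prepend-y F with bp (c ∷ p) Scp (<⇒≤ len-w) F
        ... | gs , concat-gs , refl with concat≡∷ gs (groups-nonempty (allG F)) concat-gs
        ...   | g , _ , refl =
          G⇒¬proper Gyw (2≤length-++ (G-nonempty y Gy) w≢[]) (s≤s (s≤s z≤n)) (∷-factorization Gy y⪯head F)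
          where
            y⪯head : y ⪯ concat (c ∷ g)
            y⪯head = y⪯concat c g (++⁻ˡ (c ∷ g) (subst (All S) (sym concat-gs) Scp))
                       (≤-<-trans (length-head-factor≤ F) len-w) (All.head (allG F))

    -- Two consecutive factors cannot meet between the x and the y of a glued block.
    xy-uncut : ∀ g p → All S g → All S p → G (concat (g ++ x ∷ [])) → G (y ++ concat p) →
      concat (g ++ x ∷ []) ⪯ y ++ concat p → length (concat (g ++ x ∷ []) ++ y ++ concat p) ≤ L → ⊥
    xy-uncut g [] Sg _ GA _ A⪯y len = ≺⇒⋡ Gy GA y≺A (subst (_ ⪯_) (++-identityʳ y) A⪯y)
      where
        y≺A : y ≺ concat (g ++ x ∷ [])
        y≺A = y≺concat-∷ʳx g Sg (<-≤-trans (length-++-<ˡ (concat (g ++ x ∷ [])) y++≢[]) len) GA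
    xy-uncut g (c ∷ p) _ Scp GA GB _ len =
      y++concat∉G c p Scp (<-≤-trans (length-++-<ʳ _ (G-nonempty _ GA)) len) GB

    S⁺ : Pred (Word n) 0ℓ
    S⁺ = S ∪ ｛ x ++ y ｝

    expand : ∀ vs → All S⁺ vs → List (Word n)
    expand []       []             = []
    expand (v ∷ vs) (inj₁ _ ∷ S⁺vs) = v ∷ expand vs S⁺vs
    expand (_ ∷ vs) (inj₂ _ ∷ S⁺vs) = x ∷ y ∷ expand vs S⁺vs

    concat-expand : ∀ vs (S⁺vs : All S⁺ vs) → concat (expand vs S⁺vs) ≡ concat vs
    concat-expand []       []              = refl
    concat-expand (v ∷ vs) (inj₁ _ ∷ S⁺vs)   = cong (v ++_) (concat-expand vs S⁺vs)
    concat-expand (_ ∷ vs) (inj₂ refl ∷ S⁺vs) =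
      trans (sym (++-assoc x y _)) (cong ((x ++ y) ++_) (concat-expand vs S⁺vs))

    All-expand : ∀ vs (S⁺vs : All S⁺ vs) → All S (expand vs S⁺vs)
    All-expand []       []               = []
    All-expand (_ ∷ vs) (inj₁ Sv ∷ S⁺vs) = Sv ∷ All-expand vs S⁺vs
    All-expand (_ ∷ vs) (inj₂ _ ∷ S⁺vs)  = Sx ∷ Sy ∷ All-expand vs S⁺vs

    data ExpandSplit (vs g r : List (Word n)) : Set where
      at-block  : ∀ v₁ vs₂ (S⁺v₁ : All S⁺ v₁) (S⁺vs₂ : All S⁺ vs₂) →
                  vs ≡ v₁ ++ vs₂ → g ≡ expand v₁ S⁺v₁ → r ≡ expand vs₂ S⁺vs₂ → ExpandSplit vs g r
      inside-xy : ∀ g₀ r₀ → g ≡ g₀ ++ x ∷ [] → r ≡ y ∷ r₀ → ExpandSplit vs g r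

    split-expand : ∀ vs (S⁺vs : All S⁺ vs) g r → expand vs S⁺vs ≡ g ++ r → ExpandSplit vs g r
    split-expand []       []     []      _ eq = at-block [] [] [] [] refl refl (sym eq)
    split-expand []       []     (_ ∷ _) _ ()
    split-expand (v ∷ vs) S⁺vs   []      _ eq = at-block [] (v ∷ vs) [] S⁺vs refl refl (sym eq)
    split-expand (v ∷ vs) (inj₁ Sv ∷ S⁺vs) (_ ∷ g) r eq with ∷-injective eq
    ... | refl , eq′ with split-expand vs S⁺vs g r eq′
    ...   | at-block v₁ vs₂ S⁺v₁ S⁺vs₂ p q t =
      at-block (v ∷ v₁) vs₂ (inj₁ Sv ∷ S⁺v₁) S⁺vs₂ (cong (v ∷_) p) (cong (v ∷_) q) t
    ...   | inside-xy g₀ r₀ p q = inside-xy (v ∷ g₀) r₀ (cong (v ∷_) p) q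
    split-expand (_ ∷ vs) (inj₂ _ ∷ S⁺vs) (_ ∷ []) r eq with ∷-injective eq
    ... | refl , eq′ = inside-xy [] (expand vs S⁺vs) refl (sym eq′)
    split-expand (v ∷ vs) (inj₂ xy≡v ∷ S⁺vs) (_ ∷ _ ∷ g) r eq with ∷-injective eq
    ... | refl , eq′ with ∷-injective eq′
    ...   | refl , eq″ with split-expand vs S⁺vs g r eq″
    ...     | at-block v₁ vs₂ S⁺v₁ S⁺vs₂ p q t =
      at-block (v ∷ v₁) vs₂ (inj₂ xy≡v ∷ S⁺v₁) S⁺vs₂ (cong (v ∷_) p) (cong (λ z → x ∷ y ∷ z) q) t
    ...     | inside-xy g₀ r₀ p q = inside-xy (x ∷ y ∷ g₀) r₀ (cong (λ z → x ∷ y ∷ z) p) q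

    regroup : ∀ gs vs (S⁺vs : All S⁺ vs) → concat gs ≡ expand vs S⁺vs → All (All S) gs →
      All G (map concat gs) → Linked _⪯_ (map concat gs) → length (concat (map concat gs)) ≤ L →
      PreservesBlocks vs (map concat gs)
    regroup []       []      []            _  _ _ _ _ = [] , refl , refl
    regroup []       (_ ∷ _) (inj₁ _ ∷ _) () _ _ _ _
    regroup []       (_ ∷ _) (inj₂ _ ∷ _) () _ _ _ _
    regroup (g ∷ gs) vs      S⁺vs         eq Sgs Ggs lk len with split-expand vs S⁺vs g (concat gs) (sym eq)
    ... | at-block v₁ vs₂ S⁺v₁ S⁺vs₂ refl refl concat-gs
      with regroup gs vs₂ S⁺vs₂ concat-gs (All.tail Sgs) (All.tail Ggs) (Linked.tail lk)
             (≤-trans (length-++-≤ʳ _ {concat g}) len)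
    ...   | hs , concat-hs , map-hs =
      v₁ ∷ hs , cong (v₁ ++_) concat-hs , cong₂ _∷_ (sym (concat-expand v₁ S⁺v₁)) map-hs
    regroup (g ∷ gs) vs S⁺vs eq Sgs Ggs lk len
      | inside-xy g₀ _ refl concat-gs with concat≡∷ gs (groups-nonempty (All.tail Ggs)) concat-gs
    ...   | p , _ , refl = ⊥-elim (
      xy-uncut g₀ p (++⁻ˡ g₀ (All.head Sgs)) (All.tail (All.head (All.tail Sgs)))
        (All.head Ggs) (All.head (All.tail Ggs)) (Linked.head lk) len-two-factors)
      where
        len-two-factors : length (concat (g₀ ++ x ∷ []) ++ y ++ concat p) ≤ L
        len-two-factors = ≤-trans (length-++-++-≤ (concat (g₀ ++ x ∷ [])) (y ++ concat p)) len

    preserves : BlockPreserving≤ L S⁺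
    preserves vs S⁺vs len F
      with bp (expand vs S⁺vs) (All-expand vs S⁺vs)
              (subst (λ w → length w ≤ L) (sym (concat-expand vs S⁺vs)) len)
              (subst (IsGFactorization _) (sym (concat-expand vs S⁺vs)) F)
    ... | gs , concat-gs , refl =
      regroup gs vs S⁺vs concat-gs (concat⁻ (subst (All S) (sym concat-gs) (All-expand vs S⁺vs)))
        (allG F) (nondecr F) (subst (λ w → length w ≤ L) (sym (product F)) len)

    -- The single block x ++ y is preserved, so it admits no proper G-factorization.
    merged∈G : length (x ++ y) ≤ L → G (x ++ y)
    merged∈G len = ¬proper⇒G (2≤length-++ (G-nonempty x Gx) (G-nonempty y Gy)) single-factor
      where
        single-factor : ∀ {ws} → 2 ≤ length ws → ¬ IsGFactorization ws (x ++ y)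
        single-factor 2≤ws F
          with preserves ((x ++ y) ∷ []) (inj₂ refl ∷ [])
                 (subst (λ w → length w ≤ L) (sym (++-identityʳ (x ++ y))) len)
                 (subst (IsGFactorization _) (sym (++-identityʳ (x ++ y))) F)
        ... | gs , concat-gs , refl with concat≡[ x ++ y ] gs (groups-nonempty (allG F)) concat-gs
        ...   | refl with 2≤ws
        ...     | s≤s ()

  HeadFactorization : Word n → Word n → Set
  HeadFactorization c w = ∃₂ λ e es → IsGFactorization (e ∷ es) w × c ⪯ e

  ∷-HeadFactorization : ∀ {c d w} → G c → G d → c ⪯ d → HeadFactorization d w → HeadFactorization c (c ++ w)
  ∷-HeadFactorization Gc Gd c⪯d (e , es , F , d⪯e) =
    _ , e ∷ es , ∷-factorization Gc (⪯-trans Gc Gd (All.head (allG F)) c⪯d d⪯e) F , ⪯-refl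

  ≺-HeadFactorization : ∀ {c d w} → G c → G d → c ≺ d → HeadFactorization d w → HeadFactorization c w
  ≺-HeadFactorization Gc Gd c≺d (e , es , F , d⪯e) =
    e , es , F , inj₁ (≺-⪯-trans Gc Gd (All.head (allG F)) c≺d d⪯e)

  -- A G-word has only its trivial factorization, whose factor is the word itself.
  HeadFactorization-of-G : ∀ {c t} → G (c ++ t) → c ≢ [] → t ≢ [] →
    HeadFactorization c (c ++ t) → c ≺ (c ++ t)
  HeadFactorization-of-G {c} _ _ _ (e , [] , F , inj₁ c≺e) =
    subst (c ≺_) (trans (sym (++-identityʳ e)) (product F)) c≺e
  HeadFactorization-of-G {c} _ _ t≢[] (_ , [] , F , inj₂ refl) =
    ⊥-elim (t≢[] (++-identityʳ-unique c (trans (sym (++-identityʳ c)) (product F))))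
  HeadFactorization-of-G Gw c≢[] t≢[] (_ , _ ∷ _ , F , _) =
    ⊥-elim (G⇒¬proper Gw (2≤length-++ c≢[] t≢[]) (s≤s (s≤s z≤n)) F)

  -- Gluing a ∷ b into a ++ b either leaves the first block alone or turns it into a ++ b ≻ a.
  HeadFactorization-merge : ∀ pre {a b post c cs w} → pre ++ a ∷ b ∷ post ≡ c ∷ cs → G a → G b → G (a ++ b) →
    (∀ {c′ cs′} → pre ++ (a ++ b) ∷ post ≡ c′ ∷ cs′ → HeadFactorization c′ w) → HeadFactorization c w
  HeadFactorization-merge []      refl Ga Gb Gab k =
    ≺-HeadFactorization Ga Gab (prefix-≺ _ _ Ga Gb Gab) (k refl)
  HeadFactorization-merge (_ ∷ _) refl _  _  _   k = k refl

  Descent : List (Word n) → Set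
  Descent bs = ∃₂ λ pre post → ∃₂ λ a b → bs ≡ pre ++ a ∷ b ∷ post × b ≺ a × All (b ⪯_) bs

  ∷-minimal-head-or-descent : ∀ {c m cs} → G c → G m → All G cs → All (m ⪯_) cs →
    (m ≺ c → Descent (c ∷ cs)) → All (c ⪯_) (c ∷ cs) ⊎ Descent (c ∷ cs)
  ∷-minimal-head-or-descent Gc Gm Gcs m-min descent with ⪯-or-≻ Gc Gm
  ... | inj₁ c⪯m = inj₁ (⪯-refl ∷ ⪯-All-trans Gc Gm c⪯m Gcs m-min)
  ... | inj₂ m≺c = inj₂ (descent m≺c)

  minimal-head-or-descent : ∀ {bs c cs} → bs ≡ c ∷ cs → All G bs → All (c ⪯_) bs ⊎ Descent bs
  minimal-head-or-descent {cs = []} refl _ = inj₁ (⪯-refl ∷ [])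
  minimal-head-or-descent {c = c} {d ∷ cs} refl (Gc ∷ Gds) with minimal-head-or-descent refl Gds
  ... | inj₁ d-min =
    ∷-minimal-head-or-descent Gc (All.head Gds) Gds d-min λ d≺c →
      [] , cs , c , d , refl , d≺c , inj₁ d≺c ∷ d-min
  ... | inj₂ (pre , post , a , b , eq , b≺a , b-min) =
    ∷-minimal-head-or-descent Gc Gb Gds b-min λ b≺c →
      c ∷ pre , post , a , b , cong (c ∷_) eq , b≺a , inj₁ b≺c ∷ b-min
    where
      Gb : G b
      Gb = All.lookup Gds (subst (b ∈_) (sym eq) (∈-++⁺ʳ pre (there (here refl))))

  module _ (L : ℕ) (ih : HeadBlock≺ L) where

    -- Induction on the number of blocks: if the first block is minimal, factorize the rest and
    -- prepend it; otherwise glue a minimal block to its larger left neighbour (Merge).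
    factorize : ∀ m bs {c cs} → bs ≡ c ∷ cs → length bs ≤ m → All G bs → BlockPreserving≤ L (_∈ bs) →
      length (concat bs) ≤ L → HeadFactorization c (concat bs)
    factorize _ _ {c} {[]} refl _ (Gc ∷ []) _ _ =
      c , [] , subst (IsGFactorization _) (sym (++-identityʳ c)) (singleton-factorization Gc) , ⪯-refl
    factorize zero _ {cs = _ ∷ _} refl () _ _ _
    factorize (suc m) bs {c} {d ∷ cs} bs≡ len Gbs bp lenL with minimal-head-or-descent bs≡ Gbs
    ... | inj₁ c-min with bs≡
    ...   | refl =
      ∷-HeadFactorization (All.head Gbs) (All.head (All.tail Gbs)) (All.head (All.tail c-min))
        (factorize m (d ∷ cs) refl (≤-pred len) (All.tail Gbs) (BlockPreserving≤-⊆ there bp)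
          (≤-trans (length-++-≤ʳ _ {c}) lenL))
    factorize (suc m) _ {c} {d ∷ cs} bs≡ len Gbs bp lenL | inj₂ (pre , post , a , b , refl , b≺a , b-min) =
      HeadFactorization-merge pre bs≡ Ga Gb Gab λ merged≡ →
        subst (HeadFactorization _) (concat-merge pre)
          (factorize m (pre ++ (a ++ b) ∷ post) merged≡
            (≤-pred (subst (_≤ suc m) (length-merge pre) len)) (All-merge pre Gbs Gab)
            (BlockPreserving≤-⊆ (∈-merge pre) preserves)
            (subst (λ w → length w ≤ L) (sym (concat-merge pre)) lenL))
      where
        a∈ : a ∈ pre ++ a ∷ b ∷ post
        a∈ = ∈-++⁺ʳ pre (here refl)

        b∈ : b ∈ pre ++ a ∷ b ∷ post
        b∈ = ∈-++⁺ʳ pre (there (here refl))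

        open Merge L ih (All.lookup Gbs) bp a∈ b∈ (All.lookup b-min) b≺a using (preserves; merged∈G)

        Ga : G a
        Ga = All.lookup Gbs a∈

        Gb : G b
        Gb = All.lookup Gbs b∈

        Gab : G (a ++ b)
        Gab = merged∈G (≤-trans (subst (λ w → length (a ++ b) ≤ length w) (concat-merge pre)
                                       (∈⇒length≤concat (∈-++⁺ʳ pre (here refl))))
                                lenL)

    head-block-≺-step : ∀ {S : Pred (Word n) 0ℓ} → S ⊆ G → BlockPreserving≤ L S →
      ∀ c d cs → All S (c ∷ d ∷ cs) → length (concat (c ∷ d ∷ cs)) ≤ L →
      G (concat (c ∷ d ∷ cs)) → c ≺ concat (c ∷ d ∷ cs)
    head-block-≺-step S⊆G bp c d cs Scs lenL Gw =
      HeadFactorization-of-G Gw (G-nonempty c (S⊆G (All.head Scs)))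
        (++-≢[]ˡ (G-nonempty d (S⊆G (All.head (All.tail Scs)))))
        (factorize _ (c ∷ d ∷ cs) refl ≤-refl (All.map S⊆G Scs) (BlockPreserving≤-⊆ (All.lookup Scs) bp) lenL)

  head-block-≺ : ∀ L → HeadBlock≺ L
  head-block-≺ zero    _   _  _ _ _  _ ()         _
  head-block-≺ (suc L) S⊆G bp c d cs Scs (s≤s lenL) Gw =
    head-block-≺-step L (head-block-≺ L) S⊆G (BlockPreserving≤-≤ (n≤1+n L) bp) c d cs Scs lenL Gw

open Defs using (_⪯_; BlockPreserving)

lemma3p5 : {n : ℕ} (G : Word n → Set) (_≺_ : Word n → Word n → Set) →
    NyldonLike G _≺_ →
    (pre : List (Word n)) (x y : Word n) (post : List (Word n)) →
    All G (pre ++ x ∷ y ∷ post) →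
    BlockPreserving G _≺_ (pre ++ x ∷ y ∷ post) →
    (∀ u → u ∈ (pre ++ x ∷ y ∷ post) → _⪯_ G _≺_ y u) →
    y ≺ x →
    BlockPreserving G _≺_ (pre ++ (x ++ y) ∷ post)
lemma3p5 G _≺_ NL pre x y post Gus bp y-min y≺x =
  fromBlockPreserving≤ (∈-merge pre) λ L →
    Merge.preserves L (head-block-≺ L) (All.lookup Gus) (toBlockPreserving≤ bp L)
      (∈-++⁺ʳ pre (here refl)) (∈-++⁺ʳ pre (there (here refl))) (y-min _) y≺x
  where
    open BlockPreservation G _≺_ using (toBlockPreserving≤; fromBlockPreserving≤)
    open NyldonLikeBlocks NL using (module Merge; head-block-≺)
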